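{- For all positive integers $n,d$, $$P(n,d) \ge \max\{P(n_1,d_1)\cdot P(n_2,d_2)\},$$ where the maximum is taken over all positive integers $n_1,n_2,d_1,d_2$ with $d_1+d_2=d$, $n_1+n_2=n$, and such that for some integer $a$ one has $n_1 = a d_1 + r_1$ and $n_2 = a d_2 + r_2$ with $0 \le r_1 \le d_1$ and $0 \le r_2 \le d_2$.
   Context: A permutation on $\{1,\dots,n\}$ is a sequence $(\sigma(1),\dots,\sigma(n))$ listing each element of $\{1,\dots,n\}$ exactly once. The Chebyshev distance between permutations $\sigma,\pi$ is $\max_{1\le i\le n}|\sigma(i)-\pi(i)|$. $P(n,d)$ denotes the maximum cardinality of a set of permutations on $\{1,\dots,n\}$ in which any two distinct permutations have Chebyshev distance at least $d$. -}

module Defs where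

open import Data.Nat using (ℕ; _≤_; _⊔_; ∣_-_∣)
open import Data.Fin using (Fin; toℕ)
open import Data.Fin.Permutation using (Permutation′; _⟨$⟩ʳ_)
open import Data.List using (foldr; map; allFin)
open import Data.Product using (Σ; _×_)
open import Relation.Binary.PropositionalEquality using (_≢_)

-- Permutations of {1,…,n} are modelled as permutations of Fin n = {0,…,n-1};
-- the Chebyshev distance is invariant under this shift.

chebyshev : ∀ {n} → Permutation′ n → Permutation′ n → ℕ
chebyshev {n} σ π =
  foldr _⊔_ 0 (map (λ i → ∣ toℕ (σ ⟨$⟩ʳ i) - toℕ (π ⟨$⟩ʳ i) ∣) (allFin n))

-- For d ≥ 1 this forces the members to be
-- pairwise distinct, i.e. it is a set of k permutations with minimum distance ≥ d.
IsCode : (n d k : ℕ) → (Fin k → Permutation′ n) → Set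
IsCode n d k C = ∀ i j → i ≢ j → d ≤ chebyshev (C i) (C j)

HasCode : (n d k : ℕ) → Set
HasCode n d k = Σ (Fin k → Permutation′ n) (IsCode n d k)

IsP : (n d m : ℕ) → Set
IsP n d m = HasCode n d m × (∀ k → HasCode n d k → k ≤ m)

{-# OPTIONS --safe #-}
module Submission where

-- Given codes for (n₁, d₁) and (n₂, d₂), a codeword σ ⊗ π of length n₁ + n₂
-- applies σ on the first n₁ positions and π on the last n₂, with its values
-- interleaved: after an initial run of r₂ values for π, the values 0, …, n − 1
-- are cut into blocks of d = d₁ + d₂ consecutive values, the first d₁ of each
-- block taken by σ and the last d₂ by π.  Values of σ that are d₁ apart then
-- lie in different blocks, hence end up at least d apart, and likewise for π;
-- since two distinct pairs (σ, π) ≠ (σ′, π′) differ in one component, the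
-- m₁ m₂ products form a code of minimum distance d.  The common number a of
-- blocks is what makes the leftover values r₁ ≤ d₁ and r₂ ≤ d₂ fit exactly.

open import Defs
open import Data.Fin as Fin using (Fin; toℕ; fromℕ<; punchOut; _↑ˡ_; _↑ʳ_; remQuot; combine)
open import Data.Fin.Permutation using (Permutation′; _⟨$⟩ʳ_)
open import Data.Fin.Properties
  using (toℕ<n; toℕ-fromℕ<; toℕ-injective; any?; injective⇒≤; punchOut-injective;
         +↔⊎; splitAt-↑ˡ; splitAt-↑ʳ; combine-remQuot)
open import Data.List using (map; allFin)
open import Data.List.Membership.Propositional.Properties using (∈-allFin; ∈-map⁺; ∈-map⁻; foldr-selective)
open import Data.List.Properties using (foldr-forcesᵇ)
open import Data.List.Relation.Unary.All as All using (All)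
open import Data.Nat
open import Data.Nat.DivMod
open import Data.Nat.Divisibility using (∣-refl)
open import Data.Nat.Properties
open import Data.Nat.Solver using (module +-*-Solver)
open import Data.Product using (Σ; ∃; _×_; _,_; proj₁; proj₂; uncurry)
open import Data.Sum using (_⊎_; inj₁; inj₂; [_,_]′)
open import Data.Sum.Function.Propositional using (_⊎-↔_)
open import Function using (_∘_)
open import Function.Bundles using (_↣_; Injection; mk↣; mk↔ₛ′)
open import Function.Construct.Composition using (_↣-∘_; _↔-∘_)
open import Function.Definitions using (Injective)
open import Function.Properties.Inverse using (↔⇒↣)
open import Relation.Binary.Definitions using (tri<; tri≈; tri>)
open import Relation.Binary.PropositionalEquality
  using (_≡_; _≢_; refl; sym; trans; cong; cong₂; subst; module ≡-Reasoning)
open import Relation.Nullary using (yes; no; contradiction)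

open +-*-Solver using (solve; _:+_; _:*_; _:=_; con)

<-monotone⇒injective : {f : ℕ → ℕ} → (∀ {x y} → x < y → f x < f y) → Injective _≡_ _≡_ f
<-monotone⇒injective {f} mono {x} {y} fx≡fy with <-cmp x y
... | tri< x<y _ _ = contradiction fx≡fy (<⇒≢ (mono x<y))
... | tri≈ _ x≡y _ = x≡y
... | tri> _ _ y<x = contradiction (sym fx≡fy) (<⇒≢ (mono y<x))

remainder-unique : ∀ {m n d} q r → m < d → n < d → m + q * d ≡ n + r * d → m ≡ n
remainder-unique {m} {n} {d@(suc _)} q r m<d n<d eq = begin
  m                ≡⟨ m<n⇒m%n≡m m<d ⟨
  m % d            ≡⟨ [m+kn]%n≡m%n m q d ⟨
  (m + q * d) % d  ≡⟨ cong (_% d) eq ⟩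
  (n + r * d) % d  ≡⟨ [m+kn]%n≡m%n n r d ⟩
  n % d            ≡⟨ m<n⇒m%n≡m n<d ⟩
  n                ∎
  where open ≡-Reasoning

gap⇒∣-∣-gap : ∀ {e D} (G : ℕ → ℕ) → (∀ {x y} → x + e ≤ y → G x + D ≤ G y) →
              ∀ x y → e ≤ ∣ x - y ∣ → D ≤ ∣ G x - G y ∣
gap⇒∣-∣-gap {e} {D} G gap x y e≤∣x-y∣ =
  [ (λ x≤y → ordered x≤y e≤∣x-y∣)
  , (λ y≤x → subst (D ≤_) (∣-∣-comm (G y) (G x)) (ordered y≤x (subst (e ≤_) (∣-∣-comm x y) e≤∣x-y∣)))
  ]′ (≤-total x y)
  where
  ordered : ∀ {x y} → x ≤ y → e ≤ ∣ x - y ∣ → D ≤ ∣ G x - G y ∣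
  ordered {x} {y} x≤y e≤∣x-y∣ =
    subst (D ≤_) (sym (m≤n⇒∣m-n∣≡n∸m (≤-trans (m≤m+n (G x) D) Gx+D≤Gy)))
      (m+n≤o⇒m≤o∸n D (subst (_≤ G y) (+-comm (G x) D) Gx+D≤Gy))
    where
    x+e≤y : x + e ≤ y
    x+e≤y = subst (_≤ y) (+-comm e x) (m≤o∸n⇒m+n≤o e x≤y (subst (e ≤_) (m≤n⇒∣m-n∣≡n∸m x≤y) e≤∣x-y∣))
    Gx+D≤Gy : G x + D ≤ G y
    Gx+D≤Gy = gap x+e≤y

-- stretch c p k leaves a gap of k values in front of each of the points
-- p ∸ c, 2p ∸ c, 3p ∸ c, … (for c ≤ p).
stretch : (c p k : ℕ) .{{_ : NonZero p}} → ℕ → ℕ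
stretch c p k x = x + (c + x) / p * k

module _ (c p k : ℕ) .{{_ : NonZero p}} where

  stretch-mono-≤ : ∀ {x y} → x ≤ y → stretch c p k x ≤ stretch c p k y
  stretch-mono-≤ x≤y = +-mono-≤ x≤y (*-monoˡ-≤ k (/-monoˡ-≤ p (+-monoʳ-≤ c x≤y)))

  stretch-mono-< : ∀ {x y} → x < y → stretch c p k x < stretch c p k y
  stretch-mono-< x<y = +-mono-<-≤ x<y (*-monoˡ-≤ k (/-monoˡ-≤ p (+-monoʳ-≤ c (<⇒≤ x<y))))

  stretch-+p : ∀ x → stretch c p k (x + p) ≡ stretch c p k x + (p + k)
  stretch-+p x = begin
    x + p + (c + (x + p)) / p * k     ≡⟨ cong (λ z → x + p + z / p * k) (+-assoc c x p) ⟨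
    x + p + (c + x + p) / p * k       ≡⟨ cong (λ z → x + p + z * k) (+-distrib-/-∣ʳ (c + x) ∣-refl) ⟩
    x + p + ((c + x) / p + p / p) * k ≡⟨ cong (λ z → x + p + ((c + x) / p + z) * k) (n/n≡1 p) ⟩
    x + p + ((c + x) / p + 1) * k     ≡⟨ solve 4 (λ x p q k → x :+ p :+ (q :+ con 1) :* k := x :+ q :* k :+ (p :+ k))
                                                 refl x p ((c + x) / p) k ⟩
    x + (c + x) / p * k + (p + k)     ∎
    where open ≡-Reasoning

  stretch-gap : ∀ {x y} → x + p ≤ y → stretch c p k x + (p + k) ≤ stretch c p k y
  stretch-gap {x} {y} x+p≤y = subst (_≤ stretch c p k y) (stretch-+p x) (stretch-mono-≤ x+p≤y)

  stretch-bounded : ∀ a {x b} → x < b → c + x < suc a * p → stretch c p k x < b + a * k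
  stretch-bounded a x<b c+x<[1+a]p =
    +-mono-<-≤ x<b (*-monoˡ-≤ k (m<1+n⇒m≤n (m<n*o⇒m/o<n {n = suc a} c+x<[1+a]p)))

  stretch-divMod : ∀ x → c + stretch c p k x ≡ (c + x) % p + (c + x) / p * (p + k)
  stretch-divMod x = begin
    c + (x + q * k)             ≡⟨ +-assoc c x (q * k) ⟨
    c + x + q * k               ≡⟨ cong (_+ q * k) (m≡m%n+[m/n]*n (c + x) p) ⟩
    (c + x) % p + q * p + q * k ≡⟨ solve 4 (λ r q p k → r :+ q :* p :+ q :* k := r :+ q :* (p :+ k))
                                           refl ((c + x) % p) q p k ⟩
    (c + x) % p + q * (p + k)   ∎
    where
    open ≡-Reasoning
    q : ℕ
    q = (c + x) / p

injective⇒surjective : ∀ {n} {f : Fin n → Fin n} → Injective _≡_ _≡_ f → ∀ y → ∃ λ x → f x ≡ y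
injective⇒surjective {suc n} {f} f-injective y with any? (λ x → f x Fin.≟ y)
... | yes hit  = hit
... | no  miss = contradiction (injective⇒≤ punchOut-y-injective) 1+n≰n
  where
  y≢f : ∀ x → y ≢ f x
  y≢f x y≡fx = miss (x , sym y≡fx)
  punchOut-y-injective : Injective _≡_ _≡_ (λ x → punchOut (y≢f x))
  punchOut-y-injective {x} {x′} eq = f-injective (punchOut-injective (y≢f x) (y≢f x′) eq)

injection⇒permutation : ∀ {n} → Fin n ↣ Fin n → Permutation′ n
injection⇒permutation f =
  mk↔ₛ′ to (proj₁ ∘ surjective) (proj₂ ∘ surjective) (λ x → injective (proj₂ (surjective (to x))))
  where
  open Injection f using (to; injective)
  surjective : ∀ y → ∃ λ x → to x ≡ y
  surjective = injective⇒surjective injective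

module _ {n} (σ π : Permutation′ n) where

  private
    distanceAt : Fin n → ℕ
    distanceAt i = ∣ toℕ (σ ⟨$⟩ʳ i) - toℕ (π ⟨$⟩ʳ i) ∣

  ∣-∣≤chebyshev : ∀ i → ∣ toℕ (σ ⟨$⟩ʳ i) - toℕ (π ⟨$⟩ʳ i) ∣ ≤ chebyshev σ π
  ∣-∣≤chebyshev i = All.lookup all≤ (∈-map⁺ distanceAt (∈-allFin i))
    where
    all≤ : All (_≤ chebyshev σ π) (map distanceAt (allFin n))
    all≤ = foldr-forcesᵇ (λ x y ≤c → m⊔n≤o⇒m≤o x y ≤c , m⊔n≤o⇒n≤o x y ≤c)
                         0 (map distanceAt (allFin n)) ≤-refl

  chebyshev-witness : ∀ {D} .{{_ : NonZero D}} → D ≤ chebyshev σ π →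
                      ∃ λ i → D ≤ ∣ toℕ (σ ⟨$⟩ʳ i) - toℕ (π ⟨$⟩ʳ i) ∣
  chebyshev-witness {D} D≤ with foldr-selective ⊔-sel 0 (map distanceAt (allFin n))
  ... | inj₁ ≡0 = contradiction (subst (D ≤_) ≡0 D≤) (<⇒≱ (>-nonZero⁻¹ D))
  ... | inj₂ ∈  with ∈-map⁻ distanceAt ∈
  ...   | i , _ , ≡distance = i , subst (D ≤_) ≡distance D≤

Expands : ∀ {k l} → ℕ → ℕ → (Fin k → Fin l) → Set
Expands e D f = ∀ x y → e ≤ ∣ toℕ x - toℕ y ∣ → D ≤ ∣ toℕ (f x) - toℕ (f y) ∣

chebyshev-restriction : ∀ {k n e D} .{{_ : NonZero e}} (σ σ′ : Permutation′ k) (τ τ′ : Permutation′ n)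
  (f position : Fin k → Fin n) → Expands e D f →
  (∀ i → τ ⟨$⟩ʳ position i ≡ f (σ ⟨$⟩ʳ i)) → (∀ i → τ′ ⟨$⟩ʳ position i ≡ f (σ′ ⟨$⟩ʳ i)) →
  e ≤ chebyshev σ σ′ → D ≤ chebyshev τ τ′
chebyshev-restriction {D = D} σ σ′ τ τ′ f position f-expands τ≡fσ τ′≡fσ′ e≤
  with chebyshev-witness σ σ′ e≤
... | i , e≤∣σi-σ′i∣ = begin
  D                                                            ≤⟨ f-expands _ _ e≤∣σi-σ′i∣ ⟩
  ∣ toℕ (f (σ ⟨$⟩ʳ i)) - toℕ (f (σ′ ⟨$⟩ʳ i)) ∣                 ≡⟨ cong₂ (λ u v → ∣ toℕ u - toℕ v ∣) (τ≡fσ i) (τ′≡fσ′ i) ⟨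
  ∣ toℕ (τ ⟨$⟩ʳ position i) - toℕ (τ′ ⟨$⟩ʳ position i) ∣       ≤⟨ ∣-∣≤chebyshev τ τ′ (position i) ⟩
  chebyshev τ τ′                                               ∎
  where open ≤-Reasoning

remQuot-injective : ∀ {m} n {i j : Fin (m * n)} → remQuot {m} n i ≡ remQuot n j → i ≡ j
remQuot-injective {m} n {i} {j} eq = begin
  i                                ≡⟨ combine-remQuot {m} n i ⟨
  uncurry combine (remQuot {m} n i) ≡⟨ cong (uncurry combine) eq ⟩
  uncurry combine (remQuot {m} n j) ≡⟨ combine-remQuot {m} n j ⟩
  j                                ∎
  where open ≡-Reasoning

module ProductCode {n₁ n₂ d₁ d₂ d : ℕ} .{{_ : NonZero d₁}} .{{_ : NonZero d₂}}
  (ι : Fin n₁ ⊎ Fin n₂ → Fin (n₁ + n₂)) (ι-injective : Injective _≡_ _≡_ ι)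
  (ι₁-expands : Expands d₁ d (ι ∘ inj₁)) (ι₂-expands : Expands d₂ d (ι ∘ inj₂))
  where

  infixr 7 _⊗_
  _⊗_ : Permutation′ n₁ → Permutation′ n₂ → Permutation′ (n₁ + n₂)
  σ ⊗ π = injection⇒permutation (mk↣ ι-injective ↣-∘ ↔⇒↣ ((σ ⊎-↔ π) ↔-∘ +↔⊎))

  ⊗-↑ˡ : ∀ σ π i → (σ ⊗ π) ⟨$⟩ʳ (i ↑ˡ n₂) ≡ ι (inj₁ (σ ⟨$⟩ʳ i))
  ⊗-↑ˡ σ π i rewrite splitAt-↑ˡ n₁ i n₂ = refl

  ⊗-↑ʳ : ∀ σ π i → (σ ⊗ π) ⟨$⟩ʳ (n₁ ↑ʳ i) ≡ ι (inj₂ (π ⟨$⟩ʳ i))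
  ⊗-↑ʳ σ π i rewrite splitAt-↑ʳ n₁ n₂ i = refl

  ⊗-chebyshevˡ : ∀ σ σ′ π π′ → d₁ ≤ chebyshev σ σ′ → d ≤ chebyshev (σ ⊗ π) (σ′ ⊗ π′)
  ⊗-chebyshevˡ σ σ′ π π′ =
    chebyshev-restriction σ σ′ (σ ⊗ π) (σ′ ⊗ π′) (ι ∘ inj₁) (_↑ˡ n₂) ι₁-expands (⊗-↑ˡ σ π) (⊗-↑ˡ σ′ π′)

  ⊗-chebyshevʳ : ∀ σ σ′ π π′ → d₂ ≤ chebyshev π π′ → d ≤ chebyshev (σ ⊗ π) (σ′ ⊗ π′)
  ⊗-chebyshevʳ σ σ′ π π′ =
    chebyshev-restriction π π′ (σ ⊗ π) (σ′ ⊗ π′) (ι ∘ inj₂) (n₁ ↑ʳ_) ι₂-expands (⊗-↑ʳ σ π) (⊗-↑ʳ σ′ π′)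

  ⊗-code : ∀ {m₁ m₂} → HasCode n₁ d₁ m₁ → HasCode n₂ d₂ m₂ → HasCode (n₁ + n₂) d (m₁ * m₂)
  ⊗-code {m₁} {m₂} (C₁ , C₁-code) (C₂ , C₂-code) = C , C-code
    where
    row : Fin (m₁ * m₂) → Fin m₁
    row k = proj₁ (remQuot {m₁} m₂ k)
    column : Fin (m₁ * m₂) → Fin m₂
    column k = proj₂ (remQuot {m₁} m₂ k)
    C : Fin (m₁ * m₂) → Permutation′ (n₁ + n₂)
    C k = C₁ (row k) ⊗ C₂ (column k)
    C-code : IsCode (n₁ + n₂) d (m₁ * m₂) C
    C-code k k′ k≢k′ with row k Fin.≟ row k′
    ... | no  rows≢ = ⊗-chebyshevˡ (C₁ (row k)) (C₁ (row k′)) (C₂ (column k)) (C₂ (column k′)) (C₁-code _ _ rows≢)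
    ... | yes rows≡ = ⊗-chebyshevʳ (C₁ (row k)) (C₁ (row k′)) (C₂ (column k)) (C₂ (column k′))
                        (C₂-code _ _ λ columns≡ → k≢k′ (remQuot-injective {m₁} m₂ (cong₂ _,_ rows≡ columns≡)))

module Interleaving (d₁ d₂ a r₁ r₂ : ℕ) .{{_ : NonZero d₁}} .{{_ : NonZero d₂}}
  (r₁≤d₁ : r₁ ≤ d₁) (r₂≤d₂ : r₂ ≤ d₂) where

  n₁ : ℕ
  n₁ = a * d₁ + r₁
  n₂ : ℕ
  n₂ = a * d₂ + r₂
  d : ℕ
  d = d₁ + d₂

  -- The offset with which π's values are stretched, chosen so that π's first
  -- block consists of the r₂ values preceding σ's first block.
  e : ℕ
  e = d₂ ∸ r₂

  e+r₂≡d₂ : e + r₂ ≡ d₂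
  e+r₂≡d₂ = m∸n+n≡m r₂≤d₂

  place₁ : ℕ → ℕ
  place₁ x = r₂ + stretch 0 d₁ d₂ x

  place₂ : ℕ → ℕ
  place₂ y = stretch e d₂ d₁ y

  place₁<n : ∀ {x} → x < n₁ → place₁ x < n₁ + n₂
  place₁<n {x} x<n₁ = begin-strict
    r₂ + stretch 0 d₁ d₂ x ≡⟨ +-comm r₂ _ ⟩
    stretch 0 d₁ d₂ x + r₂ <⟨ +-monoˡ-< r₂ (stretch-bounded 0 d₁ d₂ a x<n₁ x<[1+a]d₁) ⟩
    n₁ + a * d₂ + r₂       ≡⟨ +-assoc n₁ (a * d₂) r₂ ⟩
    n₁ + n₂                ∎
    where
    open ≤-Reasoning
    x<[1+a]d₁ : x < suc a * d₁
    x<[1+a]d₁ = begin-strict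
      x           <⟨ x<n₁ ⟩
      a * d₁ + r₁ ≤⟨ +-monoʳ-≤ (a * d₁) r₁≤d₁ ⟩
      a * d₁ + d₁ ≡⟨ +-comm (a * d₁) d₁ ⟩
      suc a * d₁  ∎

  place₂<n : ∀ {y} → y < n₂ → place₂ y < n₁ + n₂
  place₂<n {y} y<n₂ = begin-strict
    stretch e d₂ d₁ y <⟨ stretch-bounded e d₂ d₁ a y<n₂ e+y<[1+a]d₂ ⟩
    n₂ + a * d₁       ≤⟨ +-monoʳ-≤ n₂ (m≤m+n (a * d₁) r₁) ⟩
    n₂ + n₁           ≡⟨ +-comm n₂ n₁ ⟩
    n₁ + n₂           ∎
    where
    open ≤-Reasoning
    e+y<[1+a]d₂ : e + y < suc a * d₂
    e+y<[1+a]d₂ = begin-strict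
      e + y             <⟨ +-monoʳ-< e y<n₂ ⟩
      e + (a * d₂ + r₂) ≡⟨ +-comm e _ ⟩
      a * d₂ + r₂ + e   ≡⟨ +-assoc (a * d₂) r₂ e ⟩
      a * d₂ + (r₂ + e) ≡⟨ cong (a * d₂ +_) (trans (+-comm r₂ e) e+r₂≡d₂) ⟩
      a * d₂ + d₂       ≡⟨ +-comm (a * d₂) d₂ ⟩
      suc a * d₂        ∎

  place₁-mono-< : ∀ {x y} → x < y → place₁ x < place₁ y
  place₁-mono-< x<y = +-monoʳ-< r₂ (stretch-mono-< 0 d₁ d₂ x<y)

  place₁-gap : ∀ {x y} → x + d₁ ≤ y → place₁ x + d ≤ place₁ y
  place₁-gap {x} {y} x+d₁≤y =
    subst (_≤ place₁ y) (sym (+-assoc r₂ _ d)) (+-monoʳ-≤ r₂ (stretch-gap 0 d₁ d₂ x+d₁≤y))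

  place₂-gap : ∀ {x y} → x + d₂ ≤ y → place₂ x + d ≤ place₂ y
  place₂-gap {x} {y} x+d₂≤y =
    subst (λ z → place₂ x + z ≤ place₂ y) (+-comm d₂ d₁) (stretch-gap e d₂ d₁ x+d₂≤y)

  -- After the shift by e, σ's values are ≥ d₂ and π's are < d₂ modulo d.
  e+place₁ : ∀ x → e + place₁ x ≡ (d₂ + x % d₁) + x / d₁ * d
  e+place₁ x = begin
    e + (r₂ + stretch 0 d₁ d₂ x) ≡⟨ +-assoc e r₂ _ ⟨
    e + r₂ + stretch 0 d₁ d₂ x   ≡⟨ cong₂ _+_ e+r₂≡d₂ (stretch-divMod 0 d₁ d₂ x) ⟩
    d₂ + (x % d₁ + x / d₁ * d)   ≡⟨ +-assoc d₂ _ _ ⟨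
    d₂ + x % d₁ + x / d₁ * d     ∎
    where open ≡-Reasoning

  e+place₂ : ∀ y → e + place₂ y ≡ (e + y) % d₂ + (e + y) / d₂ * d
  e+place₂ y = trans (stretch-divMod e d₂ d₁ y) (cong (λ z → (e + y) % d₂ + (e + y) / d₂ * z) (+-comm d₂ d₁))

  place₁≢place₂ : ∀ x y → place₁ x ≢ place₂ y
  place₁≢place₂ x y eq = <⇒≱ (m%n<n (e + y) d₂) (subst (d₂ ≤_) residues≡ (m≤m+n d₂ (x % d₁)))
    where
    open ≡-Reasoning
    residues≡ : d₂ + x % d₁ ≡ (e + y) % d₂
    residues≡ = remainder-unique (x / d₁) ((e + y) / d₂)
      (subst (d₂ + x % d₁ <_) (+-comm d₂ d₁) (+-monoʳ-< d₂ (m%n<n x d₁)))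
      (<-≤-trans (m%n<n (e + y) d₂) (m≤n+m d₂ d₁))
      (begin
        d₂ + x % d₁ + x / d₁ * d          ≡⟨ e+place₁ x ⟨
        e + place₁ x                      ≡⟨ cong (e +_) eq ⟩
        e + place₂ y                      ≡⟨ e+place₂ y ⟩
        (e + y) % d₂ + (e + y) / d₂ * d   ∎)

  place : Fin n₁ ⊎ Fin n₂ → ℕ
  place = [ place₁ ∘ toℕ , place₂ ∘ toℕ ]′

  place-injective : Injective _≡_ _≡_ place
  place-injective {inj₁ x} {inj₁ x′} eq =
    cong inj₁ (toℕ-injective (<-monotone⇒injective place₁-mono-< eq))
  place-injective {inj₁ x} {inj₂ y}  eq = contradiction eq (place₁≢place₂ (toℕ x) (toℕ y))
  place-injective {inj₂ y} {inj₁ x}  eq = contradiction (sym eq) (place₁≢place₂ (toℕ x) (toℕ y))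
  place-injective {inj₂ y} {inj₂ y′} eq =
    cong inj₂ (toℕ-injective (<-monotone⇒injective (stretch-mono-< e d₂ d₁) eq))

  place<n : ∀ z → place z < n₁ + n₂
  place<n (inj₁ x) = place₁<n (toℕ<n x)
  place<n (inj₂ y) = place₂<n (toℕ<n y)

  interleave : Fin n₁ ⊎ Fin n₂ → Fin (n₁ + n₂)
  interleave z = fromℕ< (place<n z)

  toℕ-interleave : ∀ z → toℕ (interleave z) ≡ place z
  toℕ-interleave z = toℕ-fromℕ< (place<n z)

  interleave-injective : Injective _≡_ _≡_ interleave
  interleave-injective {z} {z′} eq = place-injective (begin
    place z                 ≡⟨ toℕ-interleave z ⟨
    toℕ (interleave z)      ≡⟨ cong toℕ eq ⟩
    toℕ (interleave z′)     ≡⟨ toℕ-interleave z′ ⟩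
    place z′                ∎)
    where open ≡-Reasoning

  interleave₁-expands : Expands d₁ d (interleave ∘ inj₁)
  interleave₁-expands x x′ =
    subst (d ≤_) (sym (cong₂ ∣_-_∣ (toℕ-interleave (inj₁ x)) (toℕ-interleave (inj₁ x′))))
    ∘ gap⇒∣-∣-gap place₁ place₁-gap (toℕ x) (toℕ x′)

  interleave₂-expands : Expands d₂ d (interleave ∘ inj₂)
  interleave₂-expands y y′ =
    subst (d ≤_) (sym (cong₂ ∣_-_∣ (toℕ-interleave (inj₂ y)) (toℕ-interleave (inj₂ y′))))
    ∘ gap⇒∣-∣-gap place₂ place₂-gap (toℕ y) (toℕ y′)

  open ProductCode interleave interleave-injective interleave₁-expands interleave₂-expands public
    using (⊗-code)

theorem4 : (n d n₁ n₂ d₁ d₂ : ℕ) →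
    n ≥ 1 → d ≥ 1 → n₁ ≥ 1 → n₂ ≥ 1 → d₁ ≥ 1 → d₂ ≥ 1 →
    d₁ + d₂ ≡ d → n₁ + n₂ ≡ n →
    Σ ℕ (λ a → Σ ℕ (λ r₁ → Σ ℕ (λ r₂ →
      (n₁ ≡ a * d₁ + r₁) × (r₁ ≤ d₁) × (n₂ ≡ a * d₂ + r₂) × (r₂ ≤ d₂)))) →
    (m m₁ m₂ : ℕ) → IsP n d m → IsP n₁ d₁ m₁ → IsP n₂ d₂ m₂ →
    m₁ * m₂ ≤ m
theorem4 _ _ _ _ d₁ d₂ _ _ _ _ d₁≥1 d₂≥1 refl refl (a , r₁ , r₂ , refl , r₁≤d₁ , refl , r₂≤d₂)
         m m₁ m₂ (_ , maximal) (code₁ , _) (code₂ , _) =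
  maximal (m₁ * m₂) (⊗-code code₁ code₂)
  where
  instance
    d₁-nonZero : NonZero d₁
    d₁-nonZero = >-nonZero d₁≥1
    d₂-nonZero : NonZero d₂
    d₂-nonZero = >-nonZero d₂≥1
  open Interleaving d₁ d₂ a r₁ r₂ r₁≤d₁ r₂≤d₂ using (⊗-code)
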